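{- Let $n\ge 1$ be an integer and let $A$ be a distributive meet-complemented lattice in which $\Box a$ exists for every $a\in A$ and such that $\Box^{n+1}a=\Box^n a$ for every $a\in A$. Then for every $a\in A$ the element $Ba$ exists and $Ba=\Box^n a$.
   Context: A meet-complemented lattice is a lattice $(A,\wedge,\vee)$ such that for every $a\in A$ the element $\neg a=\max\{b\in A: a\wedge b\le c\text{ for all }c\in A\}$ exists; it is bounded, with least element $0$ and greatest element $1$. For $a\in A$, $\Box a=\max\{b\in A: a\vee\neg b=1\}$, $\Box^1a=\Box a$, $\Box^{k+1}a=\Box\Box^k a$, and $Ba=\max\{b\in A: b\le a\text{ and } b\vee\neg b=1\}$ (the greatest Boolean element below $a$). -}

module Defs where

open import Level using (_⊔_)
open import Data.Nat using (ℕ; zero; suc)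
open import Data.Product using (_×_; Σ; _,_)
open import Relation.Binary.Lattice.Bundles using (DistributiveLattice)

module MC {c ℓ₁ ℓ₂} (L : DistributiveLattice c ℓ₁ ℓ₂) where
  open DistributiveLattice L

  IsMax : ∀ {p} → (Carrier → Set p) → Carrier → Set (c ⊔ ℓ₂ ⊔ p)
  IsMax P m = P m × (∀ b → P b → b ≤ m)

  IsTop : Carrier → Set (c ⊔ ℓ₂)
  IsTop x = ∀ y → y ≤ x

  IsMeetComplement : Carrier → Carrier → Set (c ⊔ ℓ₂)
  IsMeetComplement a = IsMax (λ b → ∀ d → (a ∧ b) ≤ d)

  IsMeetComplementation : (Carrier → Carrier) → Set (c ⊔ ℓ₂)
  IsMeetComplementation neg = ∀ a → IsMeetComplement a (neg a)

  module _ (neg : Carrier → Carrier) where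
    IsBox : Carrier → Carrier → Set (c ⊔ ℓ₂)
    IsBox a = IsMax (λ b → IsTop (a ∨ neg b))

    IsBoxOperation : (Carrier → Carrier) → Set (c ⊔ ℓ₂)
    IsBoxOperation box = ∀ a → IsBox a (box a)

    IsB : Carrier → Carrier → Set (c ⊔ ℓ₂)
    IsB a = IsMax (λ b → (b ≤ a) × IsTop (b ∨ neg b))

  iter : ℕ → (Carrier → Carrier) → Carrier → Carrier
  iter zero    f x = x
  iter (suc k) f x = f (iter k f x)

-- Call b Boolean when b ∨ ¬b = 1. The proof rests on three facts about □:
--   (1) □ is deflationary, □a ≤ a: from a ∨ ¬□a = 1 and distributivity,
--       □a = □a ∧ (a ∨ ¬□a) = (□a ∧ a) ∨ (□a ∧ ¬□a) ≤ a;
--   (2) a Boolean b ≤ a lies below □a, since a ∨ ¬b ≥ b ∨ ¬b = 1;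
--   (3) a post-fixed point x ≤ □x is Boolean, since ¬ is antitone and
--       1 = x ∨ ¬□x ≤ x ∨ ¬x.
-- Facts (1) and (2) pass to every iterate □ᵏ by induction on k, so □ⁿa ≤ a
-- and every Boolean b ≤ a lies below □ⁿa; the hypothesis □(□ⁿa) = □ⁿa makes
-- □ⁿa Boolean by (3).
module Submission where

open import Defs
open import Data.Nat using (ℕ; zero; suc)
import Data.Nat as Nat
open import Level using (_⊔_)
open import Data.Product using (_×_; _,_; proj₁; proj₂)
open import Relation.Binary.Lattice.Bundles using (DistributiveLattice)
import Relation.Binary.Lattice.Properties.JoinSemilattice as JoinProperties
import Relation.Binary.Lattice.Properties.MeetSemilattice as MeetProperties
import Relation.Binary.Reasoning.PartialOrder as ≤-Reasoning

module Iteration {c ℓ₁ ℓ₂} (L : DistributiveLattice c ℓ₁ ℓ₂) where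
  open DistributiveLattice L
  open MC L using (iter)

  iter-deflationary : ∀ {f} → (∀ x → f x ≤ x) → ∀ k x → iter k f x ≤ x
  iter-deflationary     f≤id zero    x = refl
  iter-deflationary {f} f≤id (suc k) x =
    trans (f≤id (iter k f x)) (iter-deflationary f≤id k x)

  iter-preserves-lower-bound : ∀ {f} b → (∀ x → b ≤ x → b ≤ f x) →
                               ∀ k x → b ≤ x → b ≤ iter k f x
  iter-preserves-lower-bound     b pres zero    x b≤x = b≤x
  iter-preserves-lower-bound {f} b pres (suc k) x b≤x =
    pres (iter k f x) (iter-preserves-lower-bound b pres k x b≤x)

module BoxProperties {c ℓ₁ ℓ₂} (L : DistributiveLattice c ℓ₁ ℓ₂)
  (neg : DistributiveLattice.Carrier L → DistributiveLattice.Carrier L)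
  (isNeg : MC.IsMeetComplementation L neg)
  (box : DistributiveLattice.Carrier L → DistributiveLattice.Carrier L)
  (isBox : MC.IsBoxOperation L neg box) where
  open DistributiveLattice L
  open MC L
  open JoinProperties joinSemilattice using (∨-monotonic)
  open MeetProperties meetSemilattice using (∧-monotonic)

  IsBoolean : Carrier → Set (c ⊔ ℓ₂)
  IsBoolean b = IsTop (b ∨ neg b)

  ∧-neg-bottom : ∀ a d → a ∧ neg a ≤ d
  ∧-neg-bottom a = proj₁ (isNeg a)

  -- ¬ is antitone: ¬y is disjoint from x ≤ y, hence below ¬x.
  neg-antitone : ∀ {x y} → x ≤ y → neg y ≤ neg x
  neg-antitone {x} {y} x≤y = proj₂ (isNeg x) (neg y)
    (λ d → trans (∧-monotonic x≤y refl) (∧-neg-bottom y d))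

  -- Fact (1): □a ≤ a, using a ∨ ¬□a = 1 and distributivity.
  box-deflationary : ∀ a → box a ≤ a
  box-deflationary a = begin
    box a                                 ≤⟨ ∧-greatest refl (proj₁ (isBox a) (box a)) ⟩
    box a ∧ (a ∨ neg (box a))             ≈⟨ ∧-distribˡ-∨ (box a) a (neg (box a)) ⟩
    (box a ∧ a) ∨ (box a ∧ neg (box a))   ≤⟨ ∨-least (x∧y≤y _ _) (∧-neg-bottom (box a) a) ⟩
    a                                     ∎
    where open ≤-Reasoning poset

  boolean-below-box : ∀ {a b} → b ≤ a → IsBoolean b → b ≤ box a
  boolean-below-box {a} {b} b≤a bool =
    proj₂ (isBox a) b (λ y → trans (bool y) (∨-monotonic b≤a refl))

  post-fixed-boolean : ∀ {x} → x ≤ box x → IsBoolean x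
  post-fixed-boolean {x} x≤□x y =
    trans (proj₁ (isBox x) y) (∨-monotonic refl (neg-antitone x≤□x))

proposition25 : ∀ {c ℓ₁ ℓ₂} (L : DistributiveLattice c ℓ₁ ℓ₂) (n : ℕ) → 1 Nat.≤ n →
    (neg : DistributiveLattice.Carrier L → DistributiveLattice.Carrier L) →
    MC.IsMeetComplementation L neg →
    (box : DistributiveLattice.Carrier L → DistributiveLattice.Carrier L) →
    MC.IsBoxOperation L neg box →
    (∀ a → DistributiveLattice._≈_ L (MC.iter L (suc n) box a) (MC.iter L n box a)) →
    ∀ a → MC.IsB L neg a (MC.iter L n box a)
proposition25 L n _ neg isNeg box isBox stable a =
  (□ⁿa≤a , □ⁿa-boolean) , greatest
  where
  open DistributiveLattice L using (_≤_; reflexive; module Eq)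
  open MC L using (iter)
  open Iteration L
  open BoxProperties L neg isNeg box isBox

  □ⁿa≤a : iter n box a ≤ a
  □ⁿa≤a = iter-deflationary box-deflationary n a

  □ⁿa-boolean : IsBoolean (iter n box a)
  □ⁿa-boolean = post-fixed-boolean (reflexive (Eq.sym (stable a)))

  greatest : ∀ b → b ≤ a × IsBoolean b → b ≤ iter n box a
  greatest b (b≤a , b-boolean) =
    iter-preserves-lower-bound b (λ x b≤x → boolean-below-box b≤x b-boolean) n a b≤a
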